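{- Let $r$ be a positive integer and let $F:\mathbf{Set}^r\to\mathbf{Set}$ be a decomposable $r$-sort species with composition operator $\eta$. Let $\Omega=(\Omega^{(1)},\dots,\Omega^{(r)})\ne\boldsymbol\emptyset$ be an object of $\mathbf{Set}^r$, and fix a base point $(\omega,\rho)\in\Omega$, that is, $\rho\in\{1,\dots,r\}$ and $\omega\in\Omega^{(\rho)}$. Then \[ F[\Omega]=\bigcup_{\Omega_1:\ (\omega,\rho)\in\Omega_1\subseteq\Omega}\eta\big(F_\eta[\Omega_1]\times F[\Omega-\Omega_1]\big). \]
   Context: $\mathbf{Set}$ is the category of finite sets and bijections. Objects of $\mathbf{Set}^r$ are $r$-tuples of finite sets; set operations on them are componentwise, and $\boldsymbol\emptyset=(\emptyset,\dots,\emptyset)$. For $\Omega_1=(\Omega_1^{(1)},\dots,\Omega_1^{(r)})$, $(\omega,\rho)\in\Omega_1$ means $\omega\in\Omega_1^{(\rho)}$. An $r$-sort species is a functor $F:\mathbf{Set}^r\to\mathbf{Set}$. A composition operator for $F$ is a family of injective maps $\eta_{(\Omega_1,\Omega_2)}:F[\Omega_1]\times F[\Omega_2]\to F[\Omega_1\amalg\Omega_2]$, one for each disjoint pair, with the following two properties. - Naturality: $\eta_{(\tilde\Omega_1,\tilde\Omega_2)}\circ(F[f_1]\times F[f_2])=F[f_1\amalg f_2]\circ\eta_{(\Omega_1,\Omega_2)}$ for tuples of bijections $f_i:\Omega_i\to\tilde\Omega_i$. - Axiom (D1): whenever $\Omega_1\amalg\Omega_2=\Omega=\tilde\Omega_1\amalg\tilde\Omega_2$,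 \[ \eta(F[\Omega_1]\times F[\Omega_2])\cap\eta(F[\tilde\Omega_1]\times F[\tilde\Omega_2])=\eta(\eta(F[\Omega_{11}]\times F[\Omega_{12}])\times\eta(F[\Omega_{21}]\times F[\Omega_{22}])), \] where $\Omega_{ij}=\Omega_i\cap\tilde\Omega_j$. $\eta(A\times B)$ denotes the image under the relevant $\eta$-map. $F$ is decomposable if some $F[\Omega]\ne\emptyset$ and $F$ admits a composition operator. Define $F_\eta[\boldsymbol\emptyset]=\emptyset$ and, for $\Omega\ne\boldsymbol\emptyset$, $F_\eta[\Omega]=F[\Omega]-\bigcup\eta(F[I]\times F[J])$, the union over disjoint pairs $(I,J)$ with $I\amalg J=\Omega$ and $I\ne\boldsymbol\emptyset\ne J$. -}

module Defs where

open import Data.Nat using (ℕ; _<_; _⊔_)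
open import Data.Nat.Properties using (m<n⇒m<n⊔o; m<n⇒m<o⊔n)
open import Data.Fin using (Fin)
open import Data.Bool using (Bool; true; false; _∨_; _∧_; not; T)
open import Data.Bool.Properties using (T-∨; T-∧)
open import Data.Product using (Σ; _×_; _,_; proj₁; proj₂)
open import Data.Sum using (_⊎_; inj₁; inj₂)
open import Data.Empty using (⊥)
open import Data.Unit using (⊤)
open import Relation.Nullary using (¬_)
open import Relation.Binary.PropositionalEquality
  using (_≡_; refl; sym; trans; subst; cong)
open import Relation.Binary.PropositionalEquality.Properties using (subst-subst-sym; subst-sym-subst)
open import Function.Bundles using (_↔_; _⇔_; Inverse; Equivalence; mk↔ₛ′)
open import Function.Construct.Identity using (↔-id)
open import Function.Construct.Composition using (_↔-∘_)

-- An r-tuple of finite sets (Ω^(1),…,Ω^(r)) is encoded as a finite set of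
-- "atoms" (ω , ρ) with ω a label in ℕ and ρ : Fin r its sort, so that
-- (ω , ρ) ∈ Ω  iff  ω ∈ Ω^(ρ).  Set operations are then componentwise.

Atom : ℕ → Set
Atom r = ℕ × Fin r

record Obj (r : ℕ) : Set where
  field
    mem     : Atom r → Bool
    bound   : ℕ
    bounded : ∀ n ρ → T (mem (n , ρ)) → n < bound   -- finiteness
open Obj public

module _ {r : ℕ} where

  infix 4 _∈ₒ_ _≐_ _⊆ₒ_
  _∈ₒ_ : Atom r → Obj r → Set
  a ∈ₒ Ω = T (mem Ω a)

  El : Obj r → Set
  El Ω = Σ (Atom r) λ a → a ∈ₒ Ω

  _≐_ : Obj r → Obj r → Set
  Ω ≐ Ω' = ∀ a → mem Ω a ≡ mem Ω' a

  _⊆ₒ_ : Obj r → Obj r → Set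
  Ω ⊆ₒ Ω' = ∀ a → a ∈ₒ Ω → a ∈ₒ Ω'

  Disjoint : Obj r → Obj r → Set
  Disjoint Ω Ω' = ∀ a → a ∈ₒ Ω → a ∈ₒ Ω' → ⊥

  ∅ₒ : Obj r
  ∅ₒ = record { mem = λ _ → false ; bound = 0 ; bounded = λ _ _ () }

  infixl 6 _∪ₒ_ _−ₒ_
  infixl 7 _∩ₒ_

  _∪ₒ_ : Obj r → Obj r → Obj r
  Ω ∪ₒ Ω' = record
    { mem = λ a → mem Ω a ∨ mem Ω' a
    ; bound = bound Ω ⊔ bound Ω'
    ; bounded = λ n ρ t → helper n ρ (Equivalence.to T-∨ t) }
    where
    helper : ∀ n ρ → T (mem Ω (n , ρ)) ⊎ T (mem Ω' (n , ρ)) → n < bound Ω ⊔ bound Ω'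
    helper n ρ (inj₁ p) = m<n⇒m<n⊔o (bound Ω') (bounded Ω n ρ p)
    helper n ρ (inj₂ p) = m<n⇒m<o⊔n (bound Ω) (bounded Ω' n ρ p)

  _∩ₒ_ : Obj r → Obj r → Obj r
  Ω ∩ₒ Ω' = record
    { mem = λ a → mem Ω a ∧ mem Ω' a
    ; bound = bound Ω
    ; bounded = λ n ρ t → bounded Ω n ρ (proj₁ (Equivalence.to T-∧ t)) }

  _−ₒ_ : Obj r → Obj r → Obj r
  Ω −ₒ Ω' = record
    { mem = λ a → mem Ω a ∧ not (mem Ω' a)
    ; bound = bound Ω
    ; bounded = λ n ρ t → bounded Ω n ρ (proj₁ (Equivalence.to T-∧ t)) }

  inl∪ : ∀ {Ω Ω' a} → a ∈ₒ Ω → a ∈ₒ (Ω ∪ₒ Ω')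
  inl∪ p = Equivalence.from T-∨ (inj₁ p)

  inr∪ : ∀ {Ω Ω' a} → a ∈ₒ Ω' → a ∈ₒ (Ω ∪ₒ Ω')
  inr∪ p = Equivalence.from T-∨ (inj₂ p)

  -- Morphisms of Set^r: sort-preserving bijections (componentwise bijections)

  record Mor (Ω Ω' : Obj r) : Set where
    field
      bij   : El Ω ↔ El Ω'
      sorts : ∀ x → proj₂ (proj₁ (Inverse.to bij x)) ≡ proj₂ (proj₁ x)
    to : El Ω → El Ω'
    to = Inverse.to bij

  idMor : (Ω : Obj r) → Mor Ω Ω
  idMor Ω = record { bij = ↔-id (El Ω) ; sorts = λ _ → refl }

  infixr 9 _∘M_
  _∘M_ : ∀ {Ω Ω' Ω''} → Mor Ω' Ω'' → Mor Ω Ω' → Mor Ω Ω''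
  g ∘M f = record
    { bij = Mor.bij g ↔-∘ Mor.bij f
    ; sorts = λ x → trans (Mor.sorts g (Mor.to f x)) (Mor.sorts f x) }

  castMor : ∀ {Ω Ω'} → Ω ≐ Ω' → Mor Ω Ω'
  castMor {Ω} {Ω'} e = record
    { bij = mk↔ₛ′ t f (λ { (a , p) → cong (a ,_) (subst-subst-sym (e a)) })
                      (λ { (a , p) → cong (a ,_) (subst-sym-subst (e a)) })
    ; sorts = λ _ → refl }
    where
    t : El Ω → El Ω'
    t (a , p) = a , subst T (e a) p
    f : El Ω' → El Ω
    f (a , p) = a , subst T (sym (e a)) p

record Species (r : ℕ) : Set₁ where
  field
    F₀     : Obj r → Set
    F₁     : ∀ {Ω Ω'} → Mor Ω Ω' → F₀ Ω → F₀ Ω'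
    F-id   : ∀ {Ω} (x : F₀ Ω) → F₁ (idMor Ω) x ≡ x
    F-∘    : ∀ {Ω Ω' Ω''} (g : Mor Ω' Ω'') (f : Mor Ω Ω') (x : F₀ Ω) →
             F₁ (g ∘M f) x ≡ F₁ g (F₁ f x)
    -- morphisms are equal when their underlying maps agree
    F-cong : ∀ {Ω Ω'} (f g : Mor Ω Ω') → (∀ e → Mor.to f e ≡ Mor.to g e) →
             ∀ x → F₁ f x ≡ F₁ g x
    finite : ∀ Ω → Σ ℕ λ n → F₀ Ω ↔ Fin n

module _ {r : ℕ} (F : Species r) where
  open Species F

  -- the shape of the maps η_(Ω1,Ω2) : F[Ω1] × F[Ω2] → F[Ω1 ∐ Ω2]
  -- (the disjointness proof is irrelevant: η may not depend on it)
  EtaMap : Set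
  EtaMap = ∀ {Ω₁ Ω₂ : Obj r} → .(Disjoint Ω₁ Ω₂) → F₀ Ω₁ → F₀ Ω₂ → F₀ (Ω₁ ∪ₒ Ω₂)

  All : ∀ {Ω : Obj r} → F₀ Ω → Set
  All _ = ⊤

  Image : EtaMap → (Ω Ω₁ Ω₂ : Obj r) → (F₀ Ω₁ → Set) → (F₀ Ω₂ → Set) → F₀ Ω → Set
  Image η Ω Ω₁ Ω₂ A B x =
    Σ (Disjoint Ω₁ Ω₂) λ d → Σ ((Ω₁ ∪ₒ Ω₂) ≐ Ω) λ e →
    Σ (F₀ Ω₁) λ y → Σ (F₀ Ω₂) λ z →
    A y × B z × F₁ (castMor e) (η d y z) ≡ x

  -- f₁ ∐ f₂ : g restricts to f₁ on Ω₁ and to f₂ on Ω₂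
  IsCoproductMor : ∀ {Ω₁ Ω₂ Ω̃₁ Ω̃₂ : Obj r} → Mor (Ω₁ ∪ₒ Ω₂) (Ω̃₁ ∪ₒ Ω̃₂) →
                   Mor Ω₁ Ω̃₁ → Mor Ω₂ Ω̃₂ → Set
  IsCoproductMor {Ω₁} {Ω₂} g f₁ f₂ =
    (∀ a (p : a ∈ₒ Ω₁) → proj₁ (Mor.to g (a , inl∪ {Ω = Ω₁} {Ω₂} p)) ≡ proj₁ (Mor.to f₁ (a , p))) ×
    (∀ a (p : a ∈ₒ Ω₂) → proj₁ (Mor.to g (a , inr∪ {Ω = Ω₁} {Ω₂} p)) ≡ proj₁ (Mor.to f₂ (a , p)))

  record CompositionOperator : Set₁ where
    field
      η     : EtaMap
      η-inj : ∀ {Ω₁ Ω₂ : Obj r} (d : Disjoint Ω₁ Ω₂) (x x' : F₀ Ω₁) (y y' : F₀ Ω₂) →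
              η d x y ≡ η d x' y' → x ≡ x' × y ≡ y'
      η-nat : ∀ {Ω₁ Ω₂ Ω̃₁ Ω̃₂ : Obj r} (d : Disjoint Ω₁ Ω₂) (d̃ : Disjoint Ω̃₁ Ω̃₂)
              (f₁ : Mor Ω₁ Ω̃₁) (f₂ : Mor Ω₂ Ω̃₂) (g : Mor (Ω₁ ∪ₒ Ω₂) (Ω̃₁ ∪ₒ Ω̃₂)) →
              IsCoproductMor g f₁ f₂ →
              ∀ x y → η d̃ (F₁ f₁ x) (F₁ f₂ y) ≡ F₁ g (η d x y)
      D1    : ∀ {Ω Ω₁ Ω₂ Ω̃₁ Ω̃₂ : Obj r} →
              Disjoint Ω₁ Ω₂ → (Ω₁ ∪ₒ Ω₂) ≐ Ω →
              Disjoint Ω̃₁ Ω̃₂ → (Ω̃₁ ∪ₒ Ω̃₂) ≐ Ω →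
              ∀ x →
              (Image η Ω Ω₁ Ω₂ All All x × Image η Ω Ω̃₁ Ω̃₂ All All x)
              ⇔ Image η Ω Ω₁ Ω₂
                  (Image η Ω₁ (Ω₁ ∩ₒ Ω̃₁) (Ω₁ ∩ₒ Ω̃₂) All All)
                  (Image η Ω₂ (Ω₂ ∩ₒ Ω̃₁) (Ω₂ ∩ₒ Ω̃₂) All All) x

  -- F is decomposable: some F[Ω] is nonempty and F admits a composition operator
  NonemptySomewhere : Set
  NonemptySomewhere = Σ (Obj r) F₀

  Fη : EtaMap → (Ω : Obj r) → F₀ Ω → Set
  Fη η Ω x =
    ¬ (Ω ≐ ∅ₒ) ×
    (∀ I J → ¬ (I ≐ ∅ₒ) → ¬ (J ≐ ∅ₒ) → ¬ Image η Ω I J All All x)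

module Submission where

-- Plan of the file.
--  * Generic facts: finite types (decidable equality, decidable existence,
--    injective endomaps are surjective), the set algebra of objects, and
--    finite lists of atoms (a list covering an object, sublists, counting).
--  * F[∅] is inhabited: (D1) applied twice to η(x , x'), x' a copy of x on
--    a disjoint copy of Ω, yields an element of F[Ω ∩ Ω'] = F[∅].
--  * Units: for e₀ ∈ F[∅], u ↦ η(u , e₀) is an injective endomap of the
--    finite set F[X], hence onto; likewise for η(e₀ , u).
--  * With the units, (D1) makes η-images symmetric and lets a splitting of
--    the first factor y of x = η(y , z) be regrouped into one of x.
--  * Whether y ∈ F[Ω₁] splits with two nonempty parts is decidable, since
--    the parts may be enumerated as sublists of a list covering Ω.
--  * Descent: start from x = η(x' , e₀) with Ω₁ = Ω; while the first factor
--    splits, pass to the part containing a₀.  The number of atoms of Ω₁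
--    decreases, so an indecomposable first factor is reached.

open import Defs
open import Data.Nat using (ℕ; _<_)
open import Data.Fin using (Fin)
open import Data.Product using (Σ; _×_; _,_)
open import Relation.Nullary using (¬_)

open import Data.Nat using (zero; suc; _+_; _∸_; _≤_; _≤ᵇ_; s≤s; z≤n)
open import Data.Nat.Properties
  using (<-irrefl; ≤-refl; <-≤-trans; +-mono-≤; +-mono-<-≤; +-mono-≤-<; ≤ᵇ⇒≤; ≤⇒≤ᵇ; <⇒≱;
         +-monoˡ-<; m+n∸n≡m; m∸n+n≡m; m≤n+m)
  renaming (_≟_ to _≟ℕ_)
open import Data.Fin using (punchOut)
open import Data.Fin.Properties using (any?; injective⇒≤; punchOut-injective; inj⇒≟)
  renaming (_≟_ to _≟Fin_)
open import Data.Bool using (Bool; true; false; _∨_; _∧_; not; T)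
open import Data.Bool.Properties using (T-∧; T-∨; T-irrelevant; T?; ∨-identityʳ; ∨-comm; ∧-idem; ∧-zeroʳ)
open import Data.Product using (proj₁; proj₂; ∃)
open import Data.Product.Properties using (≡-dec)
open import Data.Sum using (_⊎_; inj₁; inj₂)
open import Data.Empty using (⊥; ⊥-elim)
open import Data.Unit using (tt)
open import Data.List using (List; []; _∷_; [_]; map; _++_; filter; upTo; allFin; cartesianProduct)
open import Data.List.Relation.Unary.Any using (here; there) renaming (any? to anyˡ?)
open import Data.List.Membership.Propositional using (_∈_; find; lose)
open import Data.List.Membership.Propositional.Properties
  using (∈-map⁺; ∈-++⁺ˡ; ∈-++⁺ʳ; ∈-allFin; ∈-upTo⁺; ∈-cartesianProduct⁺; ∈-filter⁺; ∈-filter⁻)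
import Data.List.Membership.DecPropositional as DecMembership
open import Relation.Nullary using (Dec; yes; no)
open import Relation.Nullary.Decidable using (_×-dec_; does; isYes; toWitness; fromWitness)
import Relation.Nullary.Decidable as Dec
open import Relation.Unary using (Decidable)
open import Relation.Binary.Definitions using (DecidableEquality)
open import Relation.Binary.PropositionalEquality
  using (_≡_; _≢_; refl; sym; trans; cong; cong₂; subst; module ≡-Reasoning)
open import Function using (_∘_)
open import Function.Bundles using (_↔_; Inverse; Equivalence; mk↔ₛ′; mk⇔)
open import Function.Definitions using (Injective)
open import Function.Properties.Inverse using (↔⇒↣)

-- A finite set has no injective map into a smaller one, so an injective
-- endomap of Fin m hits every element.
Fin-injective⇒surjective : ∀ {m} (h : Fin m → Fin m) → Injective _≡_ _≡_ h →
                           ∀ w → ∃ λ i → h i ≡ w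
Fin-injective⇒surjective {zero}  h h-inj ()
Fin-injective⇒surjective {suc m} h h-inj w with any? (λ i → h i ≟Fin w)
... | yes hit  = hit
... | no  miss = ⊥-elim (<-irrefl refl (injective⇒≤ squeeze-injective))
  where
  avoids : ∀ i → w ≢ h i
  avoids i w≡hi = miss (i , sym w≡hi)
  -- h misses w, so it factors through Fin m
  squeeze : Fin (suc m) → Fin m
  squeeze i = punchOut (avoids i)
  squeeze-injective : Injective _≡_ _≡_ squeeze
  squeeze-injective eq = h-inj (punchOut-injective (avoids _) (avoids _) eq)

module FiniteType {A : Set} {k : ℕ} (A↔Fin : A ↔ Fin k) where
  open Inverse A↔Fin using (to; from; strictlyInverseˡ; strictlyInverseʳ)

  _≟_ : DecidableEquality A
  _≟_ = inj⇒≟ (↔⇒↣ A↔Fin)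

  ∃? : {P : A → Set} → Decidable P → Dec (∃ P)
  ∃? {P} P? = Dec.map (mk⇔ (λ (i , p) → from i , p)
                            (λ (a , p) → to a , subst P (sym (strictlyInverseʳ a)) p))
                      (any? (P? ∘ from))

  injective⇒surjective : (h : A → A) → Injective _≡_ _≡_ h → ∀ w → ∃ λ u → h u ≡ w
  injective⇒surjective h h-inj w =
    let i , hit = Fin-injective⇒surjective (to ∘ h ∘ from) h̃-inj (to w)
    in from i , to-injective hit
    where
    to-injective : Injective _≡_ _≡_ to
    to-injective {a} {b} eq =
      trans (sym (strictlyInverseʳ a)) (trans (cong from eq) (strictlyInverseʳ b))
    h̃-inj : Injective _≡_ _≡_ (to ∘ h ∘ from)
    h̃-inj {i} {j} eq =
      trans (sym (strictlyInverseˡ i)) (trans (cong to (h-inj (to-injective eq))) (strictlyInverseˡ j))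

indicator : Bool → ℕ
indicator true  = 1
indicator false = 0

indicator-mono : ∀ x y → (T x → T y) → indicator x ≤ indicator y
indicator-mono false y     _ = z≤n
indicator-mono true  true  _ = ≤-refl
indicator-mono true  false x⇒y = ⊥-elim (x⇒y tt)

indicator-< : ∀ x y → T y → ¬ T x → indicator x < indicator y
indicator-< true  y     _ x-false = ⊥-elim (x-false tt)
indicator-< false true  _ _ = ≤-refl

T-ext : ∀ {x y} → (T x → T y) → (T y → T x) → x ≡ y
T-ext {true}  {true}  _ _ = refl
T-ext {true}  {false} x⇒y _ = ⊥-elim (x⇒y tt)
T-ext {false} {true}  _ y⇒x = ⊥-elim (y⇒x tt)
T-ext {false} {false} _ _ = refl

module _ {r : ℕ} where

  ⊆-trans : {X Y Z : Obj r} → X ⊆ₒ Y → Y ⊆ₒ Z → X ⊆ₒ Z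
  ⊆-trans X⊆Y Y⊆Z a = Y⊆Z a ∘ X⊆Y a

  no-atoms⇒empty : {X : Obj r} → (∀ a → ¬ a ∈ₒ X) → X ≐ ∅ₒ
  no-atoms⇒empty {X} none a with mem X a in a∈X
  ... | true  = ⊥-elim (none a (subst T (sym a∈X) tt))
  ... | false = refl

  ∩-idem : {X : Obj r} → (X ∩ₒ X) ≐ X
  ∩-idem {X} a = ∧-idem (mem X a)

  disjoint⇒∩-empty : {X Y : Obj r} → Disjoint X Y → (X ∩ₒ Y) ≐ ∅ₒ
  disjoint⇒∩-empty {X} {Y} d = no-atoms⇒empty {X ∩ₒ Y} λ a a∈X∩Y →
    let a∈X , a∈Y = Equivalence.to T-∧ a∈X∩Y in d a a∈X a∈Y

  disjoint-− : {K X : Obj r} → Disjoint K (X −ₒ K)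
  disjoint-− {K} {X} a a∈K a∈X−K = not-both (mem K a) a∈K (proj₂ (Equivalence.to T-∧ a∈X−K))
    where
    not-both : ∀ b → T b → T (not b) → ⊥
    not-both true _ ()

  −-⊆ : (X K : Obj r) → (X −ₒ K) ⊆ₒ X
  −-⊆ X K a a∈X−K = proj₁ (Equivalence.to T-∧ a∈X−K)

  −-self : {X : Obj r} → (X −ₒ X) ≐ ∅ₒ
  −-self {X} = no-atoms⇒empty {X −ₒ X} λ a a∈X−X →
    disjoint-− {X} {X} a (proj₁ (Equivalence.to T-∧ a∈X−X)) a∈X−X

  ∪-⊆ˡ : {I J X : Obj r} → (I ∪ₒ J) ≐ X → I ⊆ₒ X
  ∪-⊆ˡ {I} {J} e a a∈I = subst T (e a) (inl∪ {Ω = I} {J} a∈I)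

  ∪-⊆ʳ : {I J X : Obj r} → (I ∪ₒ J) ≐ X → J ⊆ₒ X
  ∪-⊆ʳ {I} {J} e a a∈J = subst T (e a) (inr∪ {Ω = I} {J} a∈J)

  ∪-other : {I J X : Obj r} → (I ∪ₒ J) ≐ X → ∀ {a} → a ∈ₒ X → ¬ a ∈ₒ I → a ∈ₒ J
  ∪-other {I} {J} e {a} a∈X a∉I with Equivalence.to T-∨ (subst T (sym (e a)) a∈X)
  ... | inj₁ a∈I = ⊥-elim (a∉I a∈I)
  ... | inj₂ a∈J = a∈J

  ∪-− : {K X : Obj r} → K ⊆ₒ X → (K ∪ₒ (X −ₒ K)) ≐ X
  ∪-− {K} {X} K⊆X a = fill (mem K a) (mem X a) (K⊆X a)
    where
    fill : ∀ k x → (T k → T x) → k ∨ (x ∧ not k) ≡ x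
    fill true  true  _ = refl
    fill true  false k⇒x = ⊥-elim (k⇒x tt)
    fill false true  _ = refl
    fill false false _ = refl

  partition⇒complement : {I J X : Obj r} → Disjoint I J → (I ∪ₒ J) ≐ X → J ≐ (X −ₒ I)
  partition⇒complement {I} {J} d e a =
    trans (complement (mem I a) (mem J a) (d a)) (cong (_∧ not (mem I a)) (e a))
    where
    complement : ∀ i j → (T i → T j → ⊥) → j ≡ (i ∨ j) ∧ not i
    complement true  true  d = ⊥-elim (d tt tt)
    complement true  false _ = refl
    complement false true  _ = refl
    complement false false _ = refl

  ∩-⊆ : {I Ω₁ : Obj r} → I ⊆ₒ Ω₁ → I ≐ (Ω₁ ∩ₒ I)
  ∩-⊆ {I} {Ω₁} I⊆Ω₁ a = meet (mem I a) (mem Ω₁ a) (I⊆Ω₁ a)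
    where
    meet : ∀ i o → (T i → T o) → i ≡ o ∧ i
    meet true  true  _ = refl
    meet true  false i⇒o = ⊥-elim (i⇒o tt)
    meet false o     _ = sym (∧-zeroʳ o)

  ∩-− : {I Ω₁ Ω : Obj r} → Ω₁ ⊆ₒ Ω → (Ω₁ −ₒ I) ≐ (Ω₁ ∩ₒ (Ω −ₒ I))
  ∩-− {I} {Ω₁} {Ω} Ω₁⊆Ω a = meet (mem Ω₁ a) (mem Ω a) (mem I a) (Ω₁⊆Ω a)
    where
    meet : ∀ o w i → (T o → T w) → o ∧ not i ≡ o ∧ (w ∧ not i)
    meet true  true  i _ = refl
    meet true  false i o⇒w = ⊥-elim (o⇒w tt)
    meet false w     i _ = refl

  −-∩-⊆ : {I Ω₁ Ω : Obj r} → I ⊆ₒ Ω₁ → ∅ₒ ≐ ((Ω −ₒ Ω₁) ∩ₒ I)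
  −-∩-⊆ {I} {Ω₁} {Ω} I⊆Ω₁ a = sym (no-atoms⇒empty {(Ω −ₒ Ω₁) ∩ₒ I} outside a)
    where
    outside : ∀ a → ¬ a ∈ₒ ((Ω −ₒ Ω₁) ∩ₒ I)
    outside b b∈ = let a∈Ω−Ω₁ , a∈I = Equivalence.to T-∧ b∈ in
                   disjoint-− {Ω₁} {Ω} b (I⊆Ω₁ b a∈I) a∈Ω−Ω₁

  −-∩-− : {I Ω₁ Ω : Obj r} → I ⊆ₒ Ω₁ → (Ω −ₒ Ω₁) ≐ ((Ω −ₒ Ω₁) ∩ₒ (Ω −ₒ I))
  −-∩-− {I} {Ω₁} {Ω} I⊆Ω₁ a = meet (mem Ω a) (mem Ω₁ a) (mem I a) (I⊆Ω₁ a)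
    where
    meet : ∀ w o i → (T i → T o) → w ∧ not o ≡ (w ∧ not o) ∧ (w ∧ not i)
    meet false o     i     _ = refl
    meet true  true  i     _ = refl
    meet true  false true  i⇒o = ⊥-elim (i⇒o tt)
    meet true  false false _ = refl

-- Finite lists of atoms, used to enumerate the subobjects of an object.

sublists : {A : Set} → List A → List (List A)
sublists []      = [ [] ]
sublists (b ∷ L) = map (b ∷_) (sublists L) ++ sublists L

filter∈sublists : {A : Set} {P : A → Set} (P? : Decidable P) (L : List A) →
                  filter P? L ∈ sublists L
filter∈sublists P? []      = here refl
filter∈sublists P? (b ∷ L) with does (P? b)
... | true  = ∈-++⁺ˡ (∈-map⁺ (b ∷_) (filter∈sublists P? L))
... | false = ∈-++⁺ʳ (map (b ∷_) (sublists L)) (filter∈sublists P? L)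

module _ {r : ℕ} where

  _≟ₐ_ : DecidableEquality (Atom r)
  _≟ₐ_ = ≡-dec _≟ℕ_ _≟Fin_

  open DecMembership _≟ₐ_ using (_∈?_)

  atomsBelow : ℕ → List (Atom r)
  atomsBelow n = cartesianProduct (upTo n) (allFin r)

  ∈-atomsBelow : (X : Obj r) → ∀ {a} → a ∈ₒ X → a ∈ atomsBelow (bound X)
  ∈-atomsBelow X {n , ρ} a∈X = ∈-cartesianProduct⁺ (∈-upTo⁺ (bounded X n ρ a∈X)) (∈-allFin ρ)

  restrict : Obj r → List (Atom r) → Obj r
  restrict X S = record
    { mem     = λ a → isYes (a ∈? S) ∧ mem X a
    ; bound   = bound X
    ; bounded = λ n ρ t → bounded X n ρ (proj₂ (Equivalence.to T-∧ t)) }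

  restrict-⊆ : (X : Obj r) (S : List (Atom r)) → restrict X S ⊆ₒ X
  restrict-⊆ X S a t = proj₂ (Equivalence.to T-∧ t)

  restrict-disjoint : (X : Obj r) (S : List (Atom r)) → Disjoint (restrict X S) (X −ₒ restrict X S)
  restrict-disjoint X S = disjoint-− {K = restrict X S} {X = X}

  restrict-∪ : (X : Obj r) (S : List (Atom r)) → (restrict X S ∪ₒ (X −ₒ restrict X S)) ≐ X
  restrict-∪ X S = ∪-− {K = restrict X S} {X = X} (restrict-⊆ X S)

  restrict-filter : {K X : Obj r} (L : List (Atom r)) → (∀ {a} → a ∈ₒ K → a ∈ L) →
                    K ⊆ₒ X → restrict X (filter (T? ∘ mem K) L) ≐ K
  restrict-filter {K} {X} L covers K⊆X a = T-ext {mem (restrict X S) a} {mem K a} into-K from-K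
    where
    S : List (Atom r)
    S = filter (T? ∘ mem K) L
    into-K : a ∈ₒ restrict X S → a ∈ₒ K
    into-K t = proj₂ (∈-filter⁻ (T? ∘ mem K) {xs = L} (toWitness {a? = a ∈? S} (proj₁ (Equivalence.to T-∧ t))))
    from-K : a ∈ₒ K → a ∈ₒ restrict X S
    from-K t = Equivalence.from T-∧ (fromWitness {a? = a ∈? S} (∈-filter⁺ (T? ∘ mem K) (covers t) t) , K⊆X a t)

  Inhabited : Obj r → Set
  Inhabited X = Σ (Atom r) λ a → a ∈ₒ X

  inhabited? : (X : Obj r) (L : List (Atom r)) → (∀ {a} → a ∈ₒ X → a ∈ L) → Dec (Inhabited X)
  inhabited? X L covers with anyˡ? (T? ∘ mem X) L
  ... | yes some = yes (let a , _ , a∈X = find some in a , a∈X)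
  ... | no  none = no λ (a , a∈X) → none (lose (covers a∈X) a∈X)

  nonempty⇒inhabited : (X : Obj r) (L : List (Atom r)) → (∀ {a} → a ∈ₒ X → a ∈ L) →
                       ¬ X ≐ ∅ₒ → Inhabited X
  nonempty⇒inhabited X L covers X≠∅ with inhabited? X L covers
  ... | yes inhabited = inhabited
  ... | no  empty     = ⊥-elim (X≠∅ (no-atoms⇒empty {X = X} λ a a∈X → empty (a , a∈X)))

  size : Obj r → List (Atom r) → ℕ
  size X []      = 0
  size X (b ∷ L) = indicator (mem X b) + size X L

  size-mono : {X Y : Obj r} (L : List (Atom r)) → X ⊆ₒ Y → size X L ≤ size Y L
  size-mono         []      X⊆Y = z≤n
  size-mono {X} {Y} (b ∷ L) X⊆Y =
    +-mono-≤ (indicator-mono (mem X b) (mem Y b) (X⊆Y b)) (size-mono L X⊆Y)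

  size-< : {X Y : Obj r} {L : List (Atom r)} → X ⊆ₒ Y →
           ∀ {b} → b ∈ L → b ∈ₒ Y → ¬ b ∈ₒ X → size X L < size Y L
  size-< {X} {Y} {b ∷ L} X⊆Y (here refl) b∈Y b∉X =
    +-mono-<-≤ (indicator-< (mem X b) (mem Y b) b∈Y b∉X) (size-mono L X⊆Y)
  size-< {X} {Y} {c ∷ L} X⊆Y (there b∈L) b∈Y b∉X =
    +-mono-≤-< (indicator-mono (mem X c) (mem Y c) (X⊆Y c)) (size-< X⊆Y b∈L b∈Y b∉X)

module _ {r : ℕ} where

  El-≡ : {X : Obj r} {u v : El X} → proj₁ u ≡ proj₁ v → u ≡ v
  El-≡ {X} {a , p} {.a , q} refl = cong (a ,_) (T-irrelevant p q)

  shift : Obj r → Obj r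
  shift X = record
    { mem     = λ (n , ρ) → (bound X ≤ᵇ n) ∧ mem X (n ∸ bound X , ρ)
    ; bound   = bound X + bound X
    ; bounded = λ n ρ t → shifted-bound n ρ (Equivalence.to T-∧ t) }
    where
    shifted-bound : ∀ n ρ → T (bound X ≤ᵇ n) × T (mem X (n ∸ bound X , ρ)) → n < bound X + bound X
    shifted-bound n ρ (B≤n , n−B∈X) =
      subst (_< bound X + bound X) (m∸n+n≡m (≤ᵇ⇒≤ (bound X) n B≤n))
            (+-monoˡ-< (bound X) (bounded X (n ∸ bound X) ρ n−B∈X))

  shift-disjoint : (X : Obj r) → Disjoint X (shift X)
  shift-disjoint X (n , ρ) a∈X a∈X' =
    <⇒≱ (bounded X n ρ a∈X) (≤ᵇ⇒≤ (bound X) n (proj₁ (Equivalence.to T-∧ a∈X')))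

  shift-iso : (X : Obj r) → Mor X (shift X)
  shift-iso X = record
    { bij   = mk↔ₛ′ up down (λ u → El-≡ {shift X} (up-down u)) (λ u → El-≡ {X} (down-up u))
    ; sorts = λ _ → refl }
    where
    B : ℕ
    B = bound X
    up : El X → El (shift X)
    up ((n , ρ) , a∈X) =
      (n + B , ρ) ,
      Equivalence.from T-∧ (≤⇒≤ᵇ (m≤n+m B n) , subst (λ k → T (mem X (k , ρ))) (sym (m+n∸n≡m n B)) a∈X)
    down : El (shift X) → El X
    down ((n , ρ) , a∈X') = (n ∸ B , ρ) , proj₂ (Equivalence.to T-∧ a∈X')
    up-down : ∀ u → proj₁ (up (down u)) ≡ proj₁ u
    up-down ((n , ρ) , a∈X') = cong (_, ρ) (m∸n+n≡m (≤ᵇ⇒≤ B n (proj₁ (Equivalence.to T-∧ a∈X'))))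
    down-up : ∀ u → proj₁ (down (up u)) ≡ proj₁ u
    down-up ((n , ρ) , _) = cong (_, ρ) (m+n∸n≡m n B)

module Decomposition {r : ℕ} (F : Species r) (C : CompositionOperator F) where
  open Species F
  open CompositionOperator C

  Img : (X I J : Obj r) → F₀ X → Set
  Img X I J = Image F η X I J (All F) (All F)

  F₁-ext : {X Y : Obj r} (f g : Mor X Y) → (∀ u → proj₁ (Mor.to f u) ≡ proj₁ (Mor.to g u)) →
           ∀ w → F₁ f w ≡ F₁ g w
  F₁-ext {X} {Y} f g same = F-cong f g (λ u → El-≡ {X = Y} (same u))

  cast : {X Y : Obj r} → X ≐ Y → F₀ X → F₀ Y
  cast {X} {Y} e = F₁ (castMor {Ω = X} {Ω' = Y} e)

  cast-irrelevant : {X Y : Obj r} (e e' : X ≐ Y) (w : F₀ X) → cast e w ≡ cast e' w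
  cast-irrelevant {X} {Y} e e' = F₁-ext (castMor {Ω = X} {Ω' = Y} e) (castMor e') (λ _ → refl)

  cast-id : {X : Obj r} (e : X ≐ X) (w : F₀ X) → cast e w ≡ w
  cast-id {X} e w = trans (F₁-ext (castMor {Ω = X} {Ω' = X} e) (idMor X) (λ _ → refl) w) (F-id w)

  cast-∘ : {X Y Z : Obj r} (e₁ : X ≐ Y) (e₂ : Y ≐ Z) (e₃ : X ≐ Z) (w : F₀ X) →
           cast e₂ (cast e₁ w) ≡ cast e₃ w
  cast-∘ {X} {Y} {Z} e₁ e₂ e₃ w =
    trans (sym (F-∘ f₂ f₁ w)) (F₁-ext (f₂ ∘M f₁) (castMor e₃) (λ _ → refl) w)
    where
    f₁ : Mor X Y
    f₁ = castMor {Ω = X} {Ω' = Y} e₁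
    f₂ : Mor Y Z
    f₂ = castMor {Ω = Y} {Ω' = Z} e₂

  cast-injective : {X Y : Obj r} (e : X ≐ Y) {w w' : F₀ X} → cast e w ≡ cast e w' → w ≡ w'
  cast-injective {X} {Y} e {w} {w'} eq = begin
    w                      ≡⟨ sym (back w) ⟩
    cast e⁻¹ (cast e w)    ≡⟨ cong (cast e⁻¹) eq ⟩
    cast e⁻¹ (cast e w')   ≡⟨ back w' ⟩
    w'                     ∎
    where
    open ≡-Reasoning
    e⁻¹ : Y ≐ X
    e⁻¹ a = sym (e a)
    back : ∀ v → cast e⁻¹ (cast {Y = Y} e v) ≡ v
    back v = trans (cast-∘ e e⁻¹ (λ _ → refl) v) (cast-id _ v)

  Img-cong : {X I J I' J' : Obj r} → I ≐ I' → J ≐ J' → ∀ {x} → Img X I J x → Img X I' J' x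
  Img-cong {X} {I} {J} {I'} {J'} eI eJ {x} (d , e , u , v , _ , _ , eq) =
    d' , e' , cast eI u , cast eJ v , tt , tt , eq'
    where
    d' : Disjoint I' J'
    d' a a∈I' a∈J' = d a (subst T (sym (eI a)) a∈I') (subst T (sym (eJ a)) a∈J')
    eU : (I ∪ₒ J) ≐ (I' ∪ₒ J')
    eU a = cong₂ _∨_ (eI a) (eJ a)
    e' : (I' ∪ₒ J') ≐ X
    e' a = trans (sym (eU a)) (e a)
    open ≡-Reasoning
    eq' : cast e' (η d' (cast eI u) (cast eJ v)) ≡ x
    eq' = begin
      cast e' (η d' (cast eI u) (cast eJ v))
        ≡⟨ cong (cast e')
                (η-nat d d' (castMor eI) (castMor eJ) (castMor eU) ((λ _ _ → refl) , (λ _ _ → refl)) u v) ⟩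
      cast e' (cast eU (η d u v))
        ≡⟨ cast-∘ eU e' e (η d u v) ⟩
      cast e (η d u v)
        ≡⟨ eq ⟩
      x ∎

  Img-along : {X I J : Obj r} (d : Disjoint I J) (e : (I ∪ₒ J) ≐ X) → ∀ {x} → Img X I J x →
              Σ (F₀ I) λ u → Σ (F₀ J) λ v → cast e (η d u v) ≡ x
  Img-along d e (_ , e' , u , v , _ , _ , eq) = u , v , trans (cast-irrelevant e e' _) eq

  recombine : {Ω Ω₁ Ω₂ Ω̃₁ Ω̃₂ : Obj r} → Disjoint Ω̃₁ Ω̃₂ → (Ω̃₁ ∪ₒ Ω̃₂) ≐ Ω → ∀ {x} →
              Image F η Ω Ω₁ Ω₂ (Img Ω₁ (Ω₁ ∩ₒ Ω̃₁) (Ω₁ ∩ₒ Ω̃₂)) (Img Ω₂ (Ω₂ ∩ₒ Ω̃₁) (Ω₂ ∩ₒ Ω̃₂)) x →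
              Img Ω Ω̃₁ Ω̃₂ x
  recombine {Ω} {Ω₁} {Ω₂} {Ω̃₁} {Ω̃₂} d̃ ẽ {x} split@(d , e , _) =
    proj₂ (Equivalence.from (D1 {Ω} {Ω₁} {Ω₂} {Ω̃₁} {Ω̃₂} d e d̃ ẽ x) split)

  -- (D1) read from left to right, for x = η(u , v) split twice along the same
  -- partition (X , Y): the factor u splits along (X ∩ X , X ∩ Y), so the
  -- empty object X ∩ Y carries an F-structure
  F∅-from-disjoint : {X Y : Obj r} → Disjoint X Y → F₀ X → F₀ Y → F₀ ∅ₒ
  F∅-from-disjoint {X} {Y} d u v = cast (disjoint⇒∩-empty {X = X} {Y} d) q
    where
    x : F₀ (X ∪ₒ Y)
    x = η d u v
    split : Img (X ∪ₒ Y) X Y x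
    split = d , (λ _ → refl) , u , v , tt , tt , cast-id _ x
    q : F₀ (X ∩ₒ Y)
    q = let (_ , _ , _ , _ , (_ , _ , _ , q , _) , _) =
              Equivalence.to (D1 {X ∪ₒ Y} {X} {Y} {X} {Y} d (λ _ → refl) d (λ _ → refl) x) (split , split)
        in q

  -- F[∅] is inhabited as soon as some F[X] is (use a disjoint copy of X)
  F∅-inhabited : {X : Obj r} → F₀ X → F₀ ∅ₒ
  F∅-inhabited {X} w = F∅-from-disjoint (shift-disjoint X) w (F₁ (shift-iso X) w)

  module Units (e₀ : F₀ ∅ₒ) where

    -- u ↦ η(u , e₀) is an injective endomap of the finite set F[X], hence onto
    right-unit : {X : Obj r} (u : F₀ X) → Img X X ∅ₒ u
    right-unit {X} u =
      let u' , hit = FiniteType.injective⇒surjective (proj₂ (finite X)) h h-injective u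
      in d , e , u' , e₀ , tt , tt , hit
      where
      d : Disjoint X ∅ₒ
      d a _ ()
      e : (X ∪ₒ ∅ₒ) ≐ X
      e a = ∨-identityʳ (mem X a)
      h : F₀ X → F₀ X
      h w = cast e (η d w e₀)
      h-injective : Injective _≡_ _≡_ h
      h-injective eq = proj₁ (η-inj d _ _ e₀ e₀ (cast-injective e eq))

    -- likewise for u ↦ η(e₀ , u)
    left-unit : {X : Obj r} (u : F₀ X) → Img X ∅ₒ X u
    left-unit {X} u =
      let u' , hit = FiniteType.injective⇒surjective (proj₂ (finite X)) h h-injective u
      in d , e , e₀ , u' , tt , tt , hit
      where
      d : Disjoint ∅ₒ X
      d a ()
      e : (∅ₒ ∪ₒ X) ≐ X
      e a = refl
      h : F₀ X → F₀ X
      h w = cast e (η d e₀ w)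
      h-injective : Injective _≡_ _≡_ h
      h-injective eq = proj₂ (η-inj d e₀ e₀ _ _ (cast-injective e eq))

    -- η-images are symmetric: split u and v trivially along (J , I)
    Img-swap : {X I J : Obj r} → ∀ {x} → Img X I J x → Img X J I x
    Img-swap {X} {I} {J} (d , e , u , v , _ , _ , eq) =
      recombine d̃ ẽ (d , e , u , v , u-split , v-split , eq)
      where
      d̃ : Disjoint J I
      d̃ a a∈J a∈I = d a a∈I a∈J
      ẽ : (J ∪ₒ I) ≐ X
      ẽ a = trans (∨-comm (mem J a) (mem I a)) (e a)
      u-split : Img I (I ∩ₒ J) (I ∩ₒ I) u
      u-split = Img-cong (λ a → sym (disjoint⇒∩-empty {X = I} {J} d a)) (λ a → sym (∩-idem {X = I} a))
                         (left-unit u)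
      v-split : Img J (J ∩ₒ J) (J ∩ₒ I) v
      v-split = Img-cong (λ a → sym (∩-idem {X = J} a)) (λ a → sym (disjoint⇒∩-empty {X = J} {I} d̃ a))
                         (right-unit v)

    regroup : {Ω Ω₁ I J : Obj r} → Ω₁ ⊆ₒ Ω → ∀ {x} →
              Image F η Ω Ω₁ (Ω −ₒ Ω₁) (Img Ω₁ I J) (All F) x → Img Ω I (Ω −ₒ I) x
    regroup {Ω} {Ω₁} {I} {J} Ω₁⊆Ω (d , e , y , z , y-split@(dIJ , eIJ , _) , _ , eq) =
      recombine (disjoint-− {K = I} {X = Ω}) (∪-− {K = I} {X = Ω} I⊆Ω)
                (d , e , y , z , y-split' , z-split , eq)
      where
      I⊆Ω₁ : I ⊆ₒ Ω₁
      I⊆Ω₁ = ∪-⊆ˡ {I = I} {J = J} {X = Ω₁} eIJ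
      I⊆Ω : I ⊆ₒ Ω
      I⊆Ω = ⊆-trans {X = I} {Y = Ω₁} {Z = Ω} I⊆Ω₁ Ω₁⊆Ω
      y-split' : Img Ω₁ (Ω₁ ∩ₒ I) (Ω₁ ∩ₒ (Ω −ₒ I)) y
      y-split' = Img-cong (∩-⊆ {I = I} {Ω₁ = Ω₁} I⊆Ω₁)
                          (λ a → trans (partition⇒complement {I = I} {J = J} {X = Ω₁} dIJ eIJ a)
                                       (∩-− {I = I} {Ω₁ = Ω₁} {Ω = Ω} Ω₁⊆Ω a))
                          y-split
      z-split : Img (Ω −ₒ Ω₁) ((Ω −ₒ Ω₁) ∩ₒ I) ((Ω −ₒ Ω₁) ∩ₒ (Ω −ₒ I)) z
      z-split = Img-cong (−-∩-⊆ {I = I} {Ω₁ = Ω₁} {Ω = Ω} I⊆Ω₁) (−-∩-− {I = I} {Ω₁ = Ω₁} {Ω = Ω} I⊆Ω₁)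
                         (left-unit z)

    module Descent (Ω : Obj r) (x : F₀ Ω) (a₀ : Atom r) where

      G : List (Atom r)
      G = atomsBelow (bound Ω)

      covers : ∀ {a} → a ∈ₒ Ω → a ∈ G
      covers = ∈-atomsBelow Ω

      listed : {Ω₁ : Obj r} → Ω₁ ⊆ₒ Ω → (X : Obj r) → X ⊆ₒ Ω₁ → ∀ {a} → a ∈ₒ X → a ∈ G
      listed Ω₁⊆Ω X X⊆Ω₁ a∈X = covers (Ω₁⊆Ω _ (X⊆Ω₁ _ a∈X))

      Splits : (Ω₁ : Obj r) → F₀ Ω₁ → Set
      Splits Ω₁ y = Σ (Obj r) λ I → Σ (Obj r) λ J → Inhabited I × Inhabited J × Img Ω₁ I J y

      Indecomposable : (Ω₁ : Obj r) → F₀ Ω₁ → Set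
      Indecomposable Ω₁ y = ∀ I J → ¬ I ≐ ∅ₒ → ¬ J ≐ ∅ₒ → ¬ Img Ω₁ I J y

      SplitsAlong : (Ω₁ : Obj r) → F₀ Ω₁ → List (Atom r) → Set
      SplitsAlong Ω₁ y S =
        Inhabited K × Inhabited (Ω₁ −ₒ K) ×
        Σ (F₀ K) λ u → Σ (F₀ (Ω₁ −ₒ K)) λ v → cast (restrict-∪ Ω₁ S) (η (restrict-disjoint Ω₁ S) u v) ≡ y
        where
        K : Obj r
        K = restrict Ω₁ S

      splitsAlong? : {Ω₁ : Obj r} → Ω₁ ⊆ₒ Ω → (y : F₀ Ω₁) → ∀ S → Dec (SplitsAlong Ω₁ y S)
      splitsAlong? {Ω₁} Ω₁⊆Ω y S =
        inhabited? K G (listed {Ω₁ = Ω₁} Ω₁⊆Ω K (restrict-⊆ Ω₁ S)) ×-dec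
        (inhabited? (Ω₁ −ₒ K) G (listed {Ω₁ = Ω₁} Ω₁⊆Ω (Ω₁ −ₒ K) (−-⊆ Ω₁ K)) ×-dec
         FiniteType.∃? (proj₂ (finite K)) λ u →
           FiniteType.∃? (proj₂ (finite (Ω₁ −ₒ K))) λ v →
             FiniteType._≟_ (proj₂ (finite Ω₁)) _ y)
        where
        K : Obj r
        K = restrict Ω₁ S

      splitsAlong-filter : {Ω₁ I J : Obj r} → Ω₁ ⊆ₒ Ω → ¬ I ≐ ∅ₒ → ¬ J ≐ ∅ₒ → ∀ {y} →
                           Img Ω₁ I J y → SplitsAlong Ω₁ y (filter (T? ∘ mem I) G)
      splitsAlong-filter {Ω₁} {I} {J} Ω₁⊆Ω I≠∅ J≠∅ split@(d , e , _) =
        nonempty⇒inhabited K G (listed {Ω₁ = Ω₁} Ω₁⊆Ω K (restrict-⊆ Ω₁ S))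
                           (λ K≐∅ → I≠∅ λ a → trans (sym (K≐I a)) (K≐∅ a)) ,
        nonempty⇒inhabited (Ω₁ −ₒ K) G (listed {Ω₁ = Ω₁} Ω₁⊆Ω (Ω₁ −ₒ K) (−-⊆ Ω₁ K))
                           (λ K'≐∅ → J≠∅ λ a → trans (sym (K'≐J a)) (K'≐∅ a)) ,
        Img-along (restrict-disjoint Ω₁ S) (restrict-∪ Ω₁ S)
                  (Img-cong (λ a → sym (K≐I a)) (λ a → sym (K'≐J a)) split)
        where
        S : List (Atom r)
        S = filter (T? ∘ mem I) G
        K : Obj r
        K = restrict Ω₁ S
        I⊆Ω₁ : I ⊆ₒ Ω₁
        I⊆Ω₁ = ∪-⊆ˡ {I = I} {J = J} {X = Ω₁} e
        K≐I : K ≐ I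
        K≐I = restrict-filter {K = I} {X = Ω₁} G (listed {Ω₁ = Ω₁} Ω₁⊆Ω I I⊆Ω₁) I⊆Ω₁
        K'≐J : (Ω₁ −ₒ K) ≐ J
        K'≐J a = trans (cong (λ k → mem Ω₁ a ∧ not k) (K≐I a))
                       (sym (partition⇒complement {I = I} {J = J} {X = Ω₁} d e a))

      -- whether the factor y ∈ F[Ω₁] splits is decidable: search all sublists of G
      split? : {Ω₁ : Obj r} → Ω₁ ⊆ₒ Ω → (y : F₀ Ω₁) → Splits Ω₁ y ⊎ Indecomposable Ω₁ y
      split? {Ω₁} Ω₁⊆Ω y with anyˡ? (splitsAlong? Ω₁⊆Ω y) (sublists G)
      ... | yes some =
        let S , _ , (K-inh , K'-inh , u , v , eq) = find some
        in inj₁ (restrict Ω₁ S , Ω₁ −ₒ restrict Ω₁ S , K-inh , K'-inh ,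
                 restrict-disjoint Ω₁ S , restrict-∪ Ω₁ S , u , v , tt , tt , eq)
      ... | no none = inj₂ λ I J I≠∅ J≠∅ split →
        none (lose (filter∈sublists (T? ∘ mem I) G) (splitsAlong-filter Ω₁⊆Ω I≠∅ J≠∅ split))

      Candidate : Obj r → Set
      Candidate Ω₁ = a₀ ∈ₒ Ω₁ × Ω₁ ⊆ₒ Ω × Img Ω Ω₁ (Ω −ₒ Ω₁) x

      Goal : Set
      Goal = Σ (Obj r) λ Ω₁ → a₀ ∈ₒ Ω₁ × Ω₁ ⊆ₒ Ω × Image F η Ω Ω₁ (Ω −ₒ Ω₁) (Fη F η Ω₁) (All F) x

      -- Ω itself is a candidate, since x = η(x' , e₀)
      whole : a₀ ∈ₒ Ω → Candidate Ω
      whole a₀∈Ω =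
        a₀∈Ω , (λ _ a∈Ω → a∈Ω) , Img-cong (λ _ → refl) (λ a → sym (−-self {X = Ω} a)) (right-unit x)

      smaller-candidate : {Ω₁ K K' : Obj r} → Ω₁ ⊆ₒ Ω →
                          Image F η Ω Ω₁ (Ω −ₒ Ω₁) (Img Ω₁ K K') (All F) x →
                          a₀ ∈ₒ K → Inhabited K' → Candidate K × size K G < size Ω₁ G
      smaller-candidate {Ω₁} {K} {K'} Ω₁⊆Ω x-split@(_ , _ , _ , _ , (dKK' , eKK' , _) , _) a₀∈K (b , b∈K') =
        (a₀∈K , ⊆-trans {X = K} {Y = Ω₁} {Z = Ω} K⊆Ω₁ Ω₁⊆Ω , regroup Ω₁⊆Ω x-split) ,
        size-< K⊆Ω₁ (covers (Ω₁⊆Ω b b∈Ω₁)) b∈Ω₁ (λ b∈K → dKK' b b∈K b∈K')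
        where
        K⊆Ω₁ : K ⊆ₒ Ω₁
        K⊆Ω₁ = ∪-⊆ˡ {I = K} {J = K'} {X = Ω₁} eKK'
        b∈Ω₁ : b ∈ₒ Ω₁
        b∈Ω₁ = ∪-⊆ʳ {I = K} {J = K'} {X = Ω₁} eKK' b b∈K'

      shrink : {Ω₁ : Obj r} → Candidate Ω₁ → Goal ⊎ Σ (Obj r) λ Ω₂ → Candidate Ω₂ × size Ω₂ G < size Ω₁ G
      shrink {Ω₁} (a₀∈Ω₁ , Ω₁⊆Ω , (d , e , y , z , _ , _ , eq)) with split? Ω₁⊆Ω y
      ... | inj₂ indecomposable =
        inj₁ (Ω₁ , a₀∈Ω₁ , Ω₁⊆Ω , d , e , y , z ,
              ((λ Ω₁≐∅ → subst T (Ω₁≐∅ a₀) a₀∈Ω₁) , indecomposable) , tt , eq)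
      ... | inj₁ (I , J , I-inh , J-inh , y-split@(_ , eIJ , _)) with T? (mem I a₀)
      ...   | yes a₀∈I = inj₂ (I , smaller-candidate Ω₁⊆Ω (d , e , y , z , y-split , tt , eq) a₀∈I J-inh)
      ...   | no  a₀∉I = inj₂ (J , smaller-candidate Ω₁⊆Ω (d , e , y , z , Img-swap y-split , tt , eq)
                                     (∪-other {I = I} {J = J} {X = Ω₁} eIJ a₀∈Ω₁ a₀∉I) I-inh)

      -- shrinking cannot go on for more than size Ω₁ G steps
      descend : ∀ n {Ω₁} → size Ω₁ G < n → Candidate Ω₁ → Goal
      descend (suc n) (s≤s size≤n) candidate with shrink candidate
      ... | inj₁ goal = goal
      ... | inj₂ (_ , candidate' , smaller) = descend n (<-≤-trans smaller size≤n) candidate'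

      factorisation : a₀ ∈ₒ Ω → Goal
      factorisation a₀∈Ω = descend (suc (size Ω G)) ≤-refl (whole a₀∈Ω)

-- Lemma 3.8.  The hypotheses 0 < r, "F is somewhere nonempty" and Ω ≠ ∅
-- are implied by the data: x ∈ F[Ω] and the base point (ω , ρ) ∈ Ω.

lemma3p8 : (r : ℕ) → 0 < r → (F : Species r) → NonemptySomewhere F →
           (C : CompositionOperator F) →
           (Ω : Obj r) → ¬ (Ω ≐ ∅ₒ) →
           (ω : ℕ) (ρ : Fin r) → (ω , ρ) ∈ₒ Ω →
           (x : Species.F₀ F Ω) →
           Σ (Obj r) λ Ω₁ → (ω , ρ) ∈ₒ Ω₁ × Ω₁ ⊆ₒ Ω ×
             Image F (CompositionOperator.η C) Ω Ω₁ (Ω −ₒ Ω₁)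
               (Fη F (CompositionOperator.η C) Ω₁) (All F) x
lemma3p8 r _ F _ C Ω _ ω ρ base∈Ω x = factorisation base∈Ω
  where
  open Decomposition F C
  -- x ∈ F[Ω] gives an element of F[∅], hence units for η
  open Units (F∅-inhabited x)
  open Descent Ω x (ω , ρ)
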